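{- Suppose that $u \geq 1$, $s$, $t$ are integers, $n=2 \cdot 3^u$, $1 \leq s, t\leq n/2$, $6 \mid s$, and $t$ is divisible by neither $2$ nor $3$. Then $\chi(C_n, \{s,t\})=3$.
   Context: $C_n$ is the cycle with vertex set $\mathbb{Z}_n=\{0,1,\dots,n-1\}$, $i$ adjacent to $i\pm1 \pmod n$; the graph distance is $\mathrm{dist}(i,j)=\min(|i-j|,\,n-|i-j|)$. For a set $D$ of positive integers, the distance graph $G(C_n,D)$ has vertex set $\mathbb{Z}_n$, with distinct $i,j$ adjacent iff $\mathrm{dist}(i,j)\in D$; $\chi(C_n,D)$ is its chromatic number. -}

module Defs where

open import Data.Nat using (ℕ; _∸_; _+_; _<_; _⊓_)
open import Data.Fin using (Fin; toℕ)
open import Data.Product using (_×_; Σ)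
open import Relation.Binary.PropositionalEquality using (_≡_)
open import Relation.Nullary using (¬_)

absDiff : ℕ → ℕ → ℕ
absDiff a b = (a ∸ b) + (b ∸ a)

-- graph distance in the cycle C_n on vertex set ℤ_n = Fin n:
-- dist(i,j) = min(|i-j|, n-|i-j|)
cdist : (n : ℕ) → Fin n → Fin n → ℕ
cdist n i j = absDiff (toℕ i) (toℕ j) ⊓ (n ∸ absDiff (toℕ i) (toℕ j))

Adj : (n : ℕ) → (ℕ → Set) → Fin n → Fin n → Set
Adj n D i j = ¬ (i ≡ j) × D (cdist n i j)

IsProperColouring : (n : ℕ) → (ℕ → Set) → (k : ℕ) → (Fin n → Fin k) → Set
IsProperColouring n D k c = ∀ i j → Adj n D i j → ¬ (c i ≡ c j)

Colourable : (n : ℕ) → (ℕ → Set) → ℕ → Set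
Colourable n D k = Σ (Fin n → Fin k) (IsProperColouring n D k)

ChromaticNumber : (n : ℕ) → (ℕ → Set) → ℕ → Set
ChromaticNumber n D k = Colourable n D k × (∀ m → m < k → ¬ Colourable n D m)

-- Write n = 2·3^u = 3m and s = 6q.  Since n divides the odd multiple 3^u·s of s, walking in
-- steps of s from 0 closes an odd cycle, so two colours never suffice.  For three colours, colour
-- i by the third of [0, n) containing k·i mod n: this is proper as soon as k·s and k·t both lie in
-- the middle third modulo n.  With q = 3^c·σ, 3 ∤ σ and m = 6·3^c·B, take k = B·κ·(6·3^c + 1)
-- where κ inverts t modulo 18·3^c: then k·t ≡ m + B and k·s is m times a non-multiple of 3.
module Submission where

open import Defs
open import Data.Nat using (ℕ; _≤_; _*_; _^_; _/_)
open import Data.Nat.Divisibility using (_∣_)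
open import Data.Sum using (_⊎_)
open import Relation.Binary.PropositionalEquality using (_≡_)
open import Relation.Nullary using (¬_)

open import Data.Nat
open import Data.Nat.Properties
open import Data.Nat.DivMod
open import Data.Nat.Divisibility
open import Data.Nat.Induction using (<-wellFounded)
open import Data.Nat.Primality using (Prime; prime[2]; prime?; prime⇒irreducible; euclidsLemma)
open import Data.Nat.Coprimality using (Coprime; coprime-Bézout; coprime-divisor)
open import Data.Nat.GCD using (module Bézout)
open import Data.Nat.Tactic.RingSolver using (solve-∀)
open import Data.Empty using (⊥-elim)
open import Data.Fin using (Fin; zero; suc; toℕ; fromℕ<)
open import Data.Fin.Properties using (toℕ<n; toℕ-fromℕ<; fromℕ<-cong; fromℕ<-injective)
open import Data.Product using (∃; ∃₂; _×_; _,_)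
open import Data.Sum using (inj₁; inj₂; [_,_]′)
open import Induction.WellFounded using (Acc; acc)
open import Relation.Binary.PropositionalEquality
open import Relation.Nullary using (yes; no)
open import Relation.Nullary.Decidable using (from-yes)

-- Stated with absDiff so that cdist n i j is definitionally cycleDist n (toℕ i) (toℕ j).
cycleDist : ℕ → ℕ → ℕ → ℕ
cycleDist n a b = absDiff a b ⊓ (n ∸ absDiff a b)

absDiff≡∣-∣ : ∀ a b → absDiff a b ≡ ∣ a - b ∣
absDiff≡∣-∣ zero    zero    = refl
absDiff≡∣-∣ zero    (suc b) = refl
absDiff≡∣-∣ (suc a) zero    = +-identityʳ (suc a)
absDiff≡∣-∣ (suc a) (suc b) = absDiff≡∣-∣ a b

cycleDist-comm : ∀ n a b → cycleDist n a b ≡ cycleDist n b a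
cycleDist-comm n a b = cong (λ δ → δ ⊓ (n ∸ δ)) (+-comm (a ∸ b) (b ∸ a))

cycleDist-+ : ∀ n a δ → cycleDist n a (a + δ) ≡ δ ⊓ (n ∸ δ)
cycleDist-+ n a δ = cong (λ δ → δ ⊓ (n ∸ δ)) (trans (absDiff≡∣-∣ a (a + δ)) (∣m-m+n∣≡n a δ))

cycleDist-refl : ∀ n a → cycleDist n a a ≡ 0
cycleDist-refl n a = cong (λ δ → δ ⊓ (n ∸ δ)) (trans (absDiff≡∣-∣ a a) (∣n-n∣≡0 a))

s⊓[n∸s]≡s : ∀ {n s} → s + s ≤ n → s ⊓ (n ∸ s) ≡ s
s⊓[n∸s]≡s {n} {s} 2s≤n = m≤n⇒m⊓n≡m (subst (_≤ n ∸ s) (m+n∸n≡m s s) (∸-monoˡ-≤ s 2s≤n))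

MiddleThird : ℕ → ℕ → Set
MiddleThird n x = ∃₂ λ r q → x ≡ r + q * n × n ≤ 3 * r × 3 * r ≤ 2 * n

module _ (n : ℕ) .{{_ : NonZero n}} where

  toℕ-mod : ∀ x → toℕ (x mod n) ≡ x % n
  toℕ-mod x = toℕ-fromℕ< (m%n<n x n)

  n≤m<2n⇒m%n≡m∸n : ∀ {m} → n ≤ m → m < n + n → m % n ≡ m ∸ n
  n≤m<2n⇒m%n≡m∸n {m} n≤m m<2n = begin
    m % n        ≡⟨ m≤n⇒[n∸m]%m≡n%m n≤m ⟨
    (m ∸ n) % n  ≡⟨ m<n⇒m%n≡m (m<n+o⇒m∸n<o m n m<2n) ⟩
    m ∸ n        ∎
    where open ≡-Reasoning

  cycleDist-step : ∀ {a s} → a < n → s + s ≤ n → cycleDist n a ((a + s) % n) ≡ s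
  cycleDist-step {a} {s} a<n 2s≤n with a + s <? n
  ... | yes a+s<n = begin
    cycleDist n a ((a + s) % n) ≡⟨ cong (cycleDist n a) (m<n⇒m%n≡m a+s<n) ⟩
    cycleDist n a (a + s)       ≡⟨ cycleDist-+ n a s ⟩
    s ⊓ (n ∸ s)                 ≡⟨ s⊓[n∸s]≡s 2s≤n ⟩
    s                           ∎
    where open ≡-Reasoning
  ... | no a+s≮n = begin
    cycleDist n a ((a + s) % n)  ≡⟨ cong₂ (cycleDist n) (sym b+[n∸s]≡a) [a+s]%n≡b ⟩
    cycleDist n (b + (n ∸ s)) b  ≡⟨ cycleDist-comm n _ b ⟩
    cycleDist n b (b + (n ∸ s))  ≡⟨ cycleDist-+ n b (n ∸ s) ⟩
    (n ∸ s) ⊓ (n ∸ (n ∸ s))      ≡⟨ cong ((n ∸ s) ⊓_) (m∸[m∸n]≡n s≤n) ⟩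
    (n ∸ s) ⊓ s                  ≡⟨ ⊓-comm (n ∸ s) s ⟩
    s ⊓ (n ∸ s)                  ≡⟨ s⊓[n∸s]≡s 2s≤n ⟩
    s                            ∎
    where
      open ≡-Reasoning
      n≤a+s : n ≤ a + s
      n≤a+s = ≮⇒≥ a+s≮n
      s≤n : s ≤ n
      s≤n = ≤-trans (m≤m+n s s) 2s≤n
      b = a + s ∸ n
      [a+s]%n≡b : (a + s) % n ≡ b
      [a+s]%n≡b = n≤m<2n⇒m%n≡m∸n n≤a+s (+-mono-<-≤ a<n s≤n)
      b+[n∸s]≡a : b + (n ∸ s) ≡ a
      b+[n∸s]≡a = +-cancelʳ-≡ s _ _ (begin
        b + (n ∸ s) + s    ≡⟨ +-assoc b (n ∸ s) s ⟩
        b + (n ∸ s + s)    ≡⟨ cong (b +_) (m∸n+n≡m s≤n) ⟩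
        b + n              ≡⟨ m∸n+n≡m n≤a+s ⟩
        a + s              ∎)

  cycleDist-reaches-+ : ∀ a δ → a + δ < n →
    (a + cycleDist n a (a + δ)) % n ≡ a + δ ⊎ (a + δ + cycleDist n a (a + δ)) % n ≡ a
  cycleDist-reaches-+ a δ a+δ<n rewrite cycleDist-+ n a δ with ⊓-sel δ (n ∸ δ)
  ... | inj₁ min≡δ rewrite min≡δ = inj₁ (m<n⇒m%n≡m a+δ<n)
  ... | inj₂ min≡n∸δ rewrite min≡n∸δ = inj₂ (begin
    (a + δ + (n ∸ δ)) % n   ≡⟨ cong (_% n) (+-assoc a δ (n ∸ δ)) ⟩
    (a + (δ + (n ∸ δ))) % n ≡⟨ cong (λ m → (a + m) % n) (m+[n∸m]≡n δ≤n) ⟩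
    (a + n) % n             ≡⟨ [m+n]%n≡m%n a n ⟩
    a % n                   ≡⟨ m<n⇒m%n≡m (≤-<-trans (m≤m+n a δ) a+δ<n) ⟩
    a                       ∎)
    where
      open ≡-Reasoning
      δ≤n : δ ≤ n
      δ≤n = ≤-trans (m≤n+m δ a) (<⇒≤ a+δ<n)

  cycleDist-reaches : ∀ {a b} → a < n → b < n →
    (a + cycleDist n a b) % n ≡ b ⊎ (b + cycleDist n a b) % n ≡ a
  cycleDist-reaches {a} {b} a<n b<n with ≤-total a b
  ... | inj₁ a≤b with m≤n⇒∃[o]m+o≡n a≤b
  ...   | δ , refl = cycleDist-reaches-+ a δ b<n
  cycleDist-reaches {a} {b} a<n b<n | inj₂ b≤a with m≤n⇒∃[o]m+o≡n b≤a
  ...   | δ , refl rewrite cycleDist-comm n (b + δ) b = [ inj₂ , inj₁ ]′ (cycleDist-reaches-+ b δ a<n)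

  3e≤2n⇒e<n : ∀ {e} → 3 * e ≤ 2 * n → e < n
  3e≤2n⇒e<n {e} 3e≤2n = *-cancelˡ-< 3 e n (≤-<-trans 3e≤2n (*-monoˡ-< n (n<1+n 2)))

  third : ℕ → ℕ
  third r = 3 * r / n

  third<3 : ∀ {r} → r < n → third r < 3
  third<3 r<n = m<n*o⇒m/o<n (*-monoʳ-< 3 r<n)

  m+n≤o⇒m/n<o/n : ∀ {a b} → a + n ≤ b → a / n < b / n
  m+n≤o⇒m/n<o/n {a} {b} a+n≤b = begin-strict
    a / n                  <⟨ n<1+n (a / n) ⟩
    suc (a / n)            ≡⟨ cong (λ m → suc (m / n)) (m+n∸n≡m a n) ⟨
    suc ((a + n ∸ n) / n)  ≡⟨ m/n≡1+[m∸n]/n (m≤n+m n a) ⟨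
    (a + n) / n            ≤⟨ /-monoˡ-≤ n a+n≤b ⟩
    b / n                  ∎
    where open ≤-Reasoning

  third-shift : ∀ {x e} → x < n → n ≤ 3 * e → 3 * e ≤ 2 * n → third x ≢ third ((x + e) % n)
  third-shift {x} {e} x<n n≤3e 3e≤2n with x + e <? n
  ... | yes x+e<n =
    <⇒≢ (subst (λ r → third x < third r) (sym (m<n⇒m%n≡m x+e<n)) (m+n≤o⇒m/n<o/n 3x+n≤3[x+e]))
    where
      3x+n≤3[x+e] : 3 * x + n ≤ 3 * (x + e)
      3x+n≤3[x+e] = ≤-trans (+-monoʳ-≤ (3 * x) n≤3e) (≤-reflexive (sym (*-distribˡ-+ 3 x e)))
  ... | no x+e≮n = >⇒≢ (subst (λ r → third r < third x) (sym [x+e]%n≡z) (m+n≤o⇒m/n<o/n 3z+n≤3x))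
    where
      n≤x+e : n ≤ x + e
      n≤x+e = ≮⇒≥ x+e≮n
      z = x + e ∸ n
      [x+e]%n≡z : (x + e) % n ≡ z
      [x+e]%n≡z = n≤m<2n⇒m%n≡m∸n n≤x+e (+-mono-< x<n (3e≤2n⇒e<n 3e≤2n))
      3z+n≤3x : 3 * z + n ≤ 3 * x
      3z+n≤3x = +-cancelʳ-≤ (2 * n) _ _ (begin
        3 * z + n + 2 * n  ≡⟨ regroup z n ⟩
        3 * (z + n)        ≡⟨ cong (3 *_) (m∸n+n≡m n≤x+e) ⟩
        3 * (x + e)        ≡⟨ *-distribˡ-+ 3 x e ⟩
        3 * x + 3 * e      ≤⟨ +-monoʳ-≤ (3 * x) 3e≤2n ⟩
        3 * x + 2 * n      ∎)
        where
          open ≤-Reasoning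
          regroup : ∀ z n → 3 * z + n + 2 * n ≡ 3 * (z + n)
          regroup = solve-∀

  m*[n%o]%o≡m*n%o : ∀ k a → (k * (a % n)) % n ≡ (k * a) % n
  m*[n%o]%o≡m*n%o k a = begin
    (k * (a % n)) % n          ≡⟨ %-distribˡ-* k (a % n) n ⟩
    (k % n * (a % n % n)) % n  ≡⟨ cong (λ r → (k % n * r) % n) (m%n%n≡m%n a n) ⟩
    (k % n * (a % n)) % n      ≡⟨ %-distribˡ-* k a n ⟨
    (k * a) % n                ∎
    where open ≡-Reasoning

  residue-shift : ∀ k {x d y} → (x + d) % n ≡ y → (k * x % n + k * d % n) % n ≡ k * y % n
  residue-shift k {x} {d} {y} x+d≡y = begin
    (k * x % n + k * d % n) % n  ≡⟨ %-distribˡ-+ (k * x) (k * d) n ⟨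
    (k * x + k * d) % n          ≡⟨ cong (_% n) (*-distribˡ-+ k x d) ⟨
    k * (x + d) % n              ≡⟨ m*[n%o]%o≡m*n%o k (x + d) ⟨
    k * ((x + d) % n) % n        ≡⟨ cong (λ r → k * r % n) x+d≡y ⟩
    k * y % n                    ∎
    where open ≡-Reasoning

  middleThird-% : ∀ {x} → MiddleThird n x → n ≤ 3 * (x % n) × 3 * (x % n) ≤ 2 * n
  middleThird-% (r , q , refl , n≤3r , 3r≤2n) =
    subst (λ m → n ≤ 3 * m × 3 * m ≤ 2 * n) (sym residue≡r) (n≤3r , 3r≤2n)
    where
      residue≡r : (r + q * n) % n ≡ r
      residue≡r = trans ([m+kn]%n≡m%n r q n) (m<n⇒m%n≡m (3e≤2n⇒e<n 3r≤2n))

  middleThird-colourable : ∀ {D : ℕ → Set} k → (∀ {d} → D d → MiddleThird n (k * d)) → Colourable n D 3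
  middleThird-colourable {D} k middle = colour , proper
    where
      colour : Fin n → Fin 3
      colour i = fromℕ< (third<3 (m%n<n (k * toℕ i) n))

      thirds-differ : ∀ {x d y} → (x + d) % n ≡ y → D d → third (k * x % n) ≢ third (k * y % n)
      thirds-differ {x} x+d≡y Dd with middleThird-% (middle Dd)
      ... | n≤3e , 3e≤2n = subst (λ r → third (k * x % n) ≢ third r) (residue-shift k x+d≡y)
                                  (third-shift (m%n<n (k * x) n) n≤3e 3e≤2n)

      proper : IsProperColouring n D 3 colour
      proper i j (_ , Dd) same with cycleDist-reaches (toℕ<n i) (toℕ<n j)
      ... | inj₁ i+d≡j = thirds-differ i+d≡j Dd (fromℕ<-injective _ _ _ _ same)
      ... | inj₂ j+d≡i = thirds-differ j+d≡i Dd (fromℕ<-injective _ _ _ _ (sym same))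

Fin1-≡ : (a b : Fin 1) → a ≡ b
Fin1-≡ zero zero = refl

≢-≢⇒≡ : {a b c : Fin 2} → a ≢ b → b ≢ c → a ≡ c
≢-≢⇒≡ {zero}     {_}        {zero}     _   _   = refl
≢-≢⇒≡ {suc zero} {_}        {suc zero} _   _   = refl
≢-≢⇒≡ {zero}     {zero}     {suc zero} a≢b _   = ⊥-elim (a≢b refl)
≢-≢⇒≡ {zero}     {suc zero} {suc zero} _   b≢c = ⊥-elim (b≢c refl)
≢-≢⇒≡ {suc zero} {zero}     {zero}     _   b≢c = ⊥-elim (b≢c refl)
≢-≢⇒≡ {suc zero} {suc zero} {zero}     a≢b _   = ⊥-elim (a≢b refl)

module _ (n : ℕ) .{{_ : NonZero n}} {D : ℕ → Set} {s : ℕ} (Ds : D s) (0<s : 0 < s) (2s≤n : s + s ≤ n) where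

  cdist-step : ∀ x → cdist n (x mod n) ((x + s) mod n) ≡ s
  cdist-step x = begin
    cycleDist n (toℕ (x mod n)) (toℕ ((x + s) mod n))
                                                        ≡⟨ cong₂ (cycleDist n) (toℕ-mod n x) (toℕ-mod n (x + s)) ⟩
    cycleDist n (x % n) ((x + s) % n)                   ≡⟨ cong (cycleDist n (x % n)) reduce-x ⟩
    cycleDist n (x % n) ((x % n + s) % n)               ≡⟨ cycleDist-step n (m%n<n x n) 2s≤n ⟩
    s                                                   ∎
    where
      open ≡-Reasoning
      reduce-x : (x + s) % n ≡ (x % n + s) % n
      reduce-x = begin
        (x + s) % n              ≡⟨ %-distribˡ-+ x s n ⟩
        (x % n + s % n) % n      ≡⟨ cong (λ m → (m + s % n) % n) (m%n%n≡m%n x n) ⟨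
        (x % n % n + s % n) % n  ≡⟨ %-distribˡ-+ (x % n) s n ⟨
        (x % n + s) % n          ∎

  step-adjacent : ∀ x → Adj n D (x mod n) ((x + s) mod n)
  step-adjacent x = distinct , subst D (sym (cdist-step x)) Ds
    where
      distinct : x mod n ≢ (x + s) mod n
      distinct same = <⇒≢ 0<s (sym (begin
        s                                  ≡⟨ cdist-step x ⟨
        cdist n (x mod n) ((x + s) mod n)  ≡⟨ cong (cdist n (x mod n)) same ⟨
        cdist n (x mod n) (x mod n)        ≡⟨ cycleDist-refl n (toℕ (x mod n)) ⟩
        0                                  ∎))
        where open ≡-Reasoning

  not-2-colourable : ∀ h → n ∣ (1 + 2 * h) * s → ¬ Colourable n D 2
  not-2-colourable h (divides q odd*s≡q*n) (c , proper) = proper (0 mod n) (s mod n) (step-adjacent 0) (begin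
    colour 0                       ≡⟨ periodic (suc h) ⟩
    colour (suc h * (s + s))       ≡⟨ cong colour (regroup h s) ⟩
    colour (s + (1 + 2 * h) * s)   ≡⟨ cong (λ m → colour (s + m)) odd*s≡q*n ⟩
    colour (s + q * n)             ≡⟨ cong c (fromℕ<-cong _ _ ([m+kn]%n≡m%n s q n) _ _) ⟩
    colour s                       ∎)
    where
      open ≡-Reasoning
      colour : ℕ → Fin 2
      colour x = c (x mod n)
      two-steps : ∀ x → colour x ≡ colour (s + s + x)
      two-steps x = trans (≢-≢⇒≡ (proper _ _ (step-adjacent x)) (proper _ _ (step-adjacent (x + s))))
                          (cong colour (trans (+-assoc x s s) (+-comm x (s + s))))
      periodic : ∀ j → colour 0 ≡ colour (j * (s + s))
      periodic zero    = refl
      periodic (suc j) = trans (periodic j) (two-steps (j * (s + s)))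
      regroup : ∀ h s → suc h * (s + s) ≡ s + (1 + 2 * h) * s
      regroup = solve-∀

  not-colourable-below-3 : ∀ h → n ∣ (1 + 2 * h) * s → ∀ k → k < 3 → ¬ Colourable n D k
  not-colourable-below-3 _ _ 0 _ (c , _) with c (0 mod n)
  ... | ()
  not-colourable-below-3 _ _ 1 _ (c , proper) = proper _ _ (step-adjacent 0) (Fin1-≡ _ _)
  not-colourable-below-3 h n∣odd*s 2 _ = not-2-colourable h n∣odd*s
  not-colourable-below-3 _ _ (suc (suc (suc _))) (s≤s (s≤s (s≤s ())))

1<3 : 1 < 3
1<3 = s≤s (s≤s z≤n)

∤⇒coprime : ∀ {p t} → Prime p → ¬ p ∣ t → Coprime t p
∤⇒coprime p-prime p∤t (d∣t , d∣p) with prime⇒irreducible p-prime d∣p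
... | inj₁ d≡1 = d≡1
... | inj₂ refl = ⊥-elim (p∤t d∣t)

coprime-* : ∀ {a x y} → Coprime a x → Coprime a y → Coprime a (x * y)
coprime-* {x = x} a⊥x a⊥y {d} (d∣a , d∣xy) = a⊥y (d∣a , coprime-divisor d⊥x d∣xy)
  where
    d⊥x : Coprime d x
    d⊥x (e∣d , e∣x) = a⊥x (∣-trans e∣d d∣a , e∣x)

coprime-^ : ∀ {a p} j → Coprime a p → Coprime a (p ^ j)
coprime-^ zero    _   (_ , d∣1) = ∣1⇒≡1 d∣1
coprime-^ (suc j) a⊥p = coprime-* a⊥p (coprime-^ j a⊥p)

-- From 1 + x·t = y·M, the multiple (M − 1)·x of x inverts t modulo M.
modular-inverse : ∀ {t M} → 1 < M → Coprime t M → ∃₂ λ κ Q → κ * t ≡ 1 + Q * M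
modular-inverse _ t⊥M with coprime-Bézout t⊥M
... | Bézout.+- x y 1+yM≡xt = x , y , sym 1+yM≡xt
... | Bézout.-+ x zero ()
modular-inverse {t} {suc (suc M')} (s≤s (s≤s z≤n)) t⊥M | Bézout.-+ x (suc y) 1+xt≡yM =
  suc M' * x , y + M' * suc y , +-cancelʳ-≡ (suc M') _ _ (begin
    suc M' * x * t + suc M'                          ≡⟨ factor M' x t ⟩
    suc M' * (1 + x * t)                             ≡⟨ cong (suc M' *_) 1+xt≡yM ⟩
    suc M' * (suc y * suc (suc M'))                  ≡⟨ expand M' y ⟨
    1 + (y + M' * suc y) * suc (suc M') + suc M'     ∎)
  where
    open ≡-Reasoning
    factor : ∀ M' x t → suc M' * x * t + suc M' ≡ suc M' * (1 + x * t)
    factor = solve-∀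
    expand : ∀ M' y → 1 + (y + M' * suc y) * suc (suc M') + suc M' ≡ suc M' * (suc y * suc (suc M'))
    expand = solve-∀

∤-* : ∀ {p a b} → Prime p → ¬ p ∣ a → ¬ p ∣ b → ¬ p ∣ a * b
∤-* {a = a} {b} p-prime p∤a p∤b p∣ab = [ p∤a , p∤b ]′ (euclidsLemma a b p-prime p∣ab)

∤1+* : ∀ {p} → 1 < p → ∀ y → ¬ p ∣ 1 + p * y
∤1+* {p} 1<p y p∣1+py = <⇒≢ 1<p (sym (∣1⇒≡1 p∣1))
  where
    p∣1 : p ∣ 1
    p∣1 = ∣m+n∣m⇒∣n (subst (p ∣_) (+-comm 1 (p * y)) p∣1+py) (m∣m*n y)

factor-powers : ∀ {p} → 1 < p → ∀ q → 0 < q → ∃₂ λ c σ → q ≡ p ^ c * σ × ¬ p ∣ σ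
factor-powers {p} 1<p q 0<q = go q 0<q (<-wellFounded q)
  where
    go : ∀ q → 0 < q → Acc _<_ q → ∃₂ λ c σ → q ≡ p ^ c * σ × ¬ p ∣ σ
    go q 0<q (acc smaller) with p ∣? q
    ... | no p∤q = 0 , q , sym (+-identityʳ q) , p∤q
    ... | yes (divides (suc r) refl) with go (suc r) z<s (smaller (m<m*n (suc r) p 1<p))
    ...   | c , σ , 1+r≡pᶜσ , p∤σ = suc c , σ , trans (cong (_* p) 1+r≡pᶜσ) (rotate (p ^ c) σ p) , p∤σ
      where
        rotate : ∀ x σ p → x * σ * p ≡ p * x * σ
        rotate = solve-∀

odd-^ : ∀ a n → ∃ λ h → (1 + 2 * a) ^ n ≡ 1 + 2 * h
odd-^ a zero    = 0 , refl
odd-^ a (suc n) with odd-^ a n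
... | h , eq = a + h + 2 * a * h , trans (cong ((1 + 2 * a) *_) eq) (expand a h)
  where
    expand : ∀ a h → (1 + 2 * a) * (1 + 2 * h) ≡ 1 + 2 * (a + h + 2 * a * h)
    expand = solve-∀

prime[3] : Prime 3
prime[3] = from-yes (prime? 3)

n≤n*e≤2n : ∀ n {e} → 1 ≤ e → e ≤ 2 → n ≤ n * e × n * e ≤ 2 * n
n≤n*e≤2n n 1≤e e≤2 = ≤-trans (≤-reflexive (sym (*-identityʳ n))) (*-monoʳ-≤ n 1≤e)
                   , ≤-trans (*-monoʳ-≤ n e≤2) (≤-reflexive (*-comm n 2))

middleThird-multiple : ∀ m {x} → ¬ 3 ∣ x → MiddleThird (3 * m) (m * x)
middleThird-multiple m {x} 3∤x = m * e , x / 3 , m*x≡ , bounds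
  where
    e = x % 3
    m*x≡ : m * x ≡ m * e + x / 3 * (3 * m)
    m*x≡ = trans (cong (m *_) (m≡m%n+[m/n]*n x 3)) (regroup m e (x / 3))
      where
        regroup : ∀ m e d → m * (e + d * 3) ≡ m * e + d * (3 * m)
        regroup = solve-∀
    1≤e : 1 ≤ e
    1≤e = n≢0⇒n>0 (λ e≡0 → 3∤x (m%n≡0⇒n∣m x 3 e≡0))
    bounds : 3 * m ≤ 3 * (m * e) × 3 * (m * e) ≤ 2 * (3 * m)
    bounds = subst (λ r → 3 * m ≤ r × r ≤ 2 * (3 * m)) (*-assoc 3 m e)
                   (n≤n*e≤2n (3 * m) 1≤e (s≤s⁻¹ (m%n<n x 3)))

middleThird-multiplier : ∀ {A B σ t} → 0 < A → ¬ 3 ∣ σ → Coprime t (18 * A) →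
  ∃ λ k → MiddleThird (3 * (6 * A * B)) (k * (6 * A * σ)) × MiddleThird (3 * (6 * A * B)) (k * t)
middleThird-multiplier {A} {B} {σ} {t} 0<A 3∤σ t⊥18A with modular-inverse 1<18A t⊥18A
  where
    1<18A : 1 < 18 * A
    1<18A = ≤-trans (s≤s (s≤s z≤n)) (*-monoʳ-≤ 18 0<A)
... | κ , Q , κt≡1+Q18A = B * (κ * w) , at-s , at-t
  where
    w = 1 + 3 * (2 * A)
    m = 6 * A * B
    3∤κ : ¬ 3 ∣ κ
    3∤κ 3∣κ = ∤1+* 1<3 (6 * A * Q)
                (subst (3 ∣_) (trans κt≡1+Q18A (cong suc (regroup A Q))) (∣m⇒∣m*n t 3∣κ))
      where
        regroup : ∀ A Q → Q * (18 * A) ≡ 3 * (6 * A * Q)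
        regroup = solve-∀
    at-s : MiddleThird (3 * m) (B * (κ * w) * (6 * A * σ))
    at-s = subst (MiddleThird (3 * m)) (regroup A B κ w σ)
             (middleThird-multiple m (∤-* prime[3] (∤-* prime[3] 3∤κ (∤1+* 1<3 (2 * A))) 3∤σ))
      where
        regroup : ∀ A B κ w σ → 6 * A * B * (κ * w * σ) ≡ B * (κ * w) * (6 * A * σ)
        regroup = solve-∀
    B≤m : B ≤ m
    B≤m = ≤-trans (m≤n*m B 6) (*-monoˡ-≤ B (*-monoʳ-≤ 6 0<A))
    at-t : MiddleThird (3 * m) (B * (κ * w) * t)
    at-t = m + B , Q * w , kt≡ , *-monoʳ-≤ 3 (m≤m+n m B) , (begin
      3 * (m + B)    ≡⟨ *-distribˡ-+ 3 m B ⟩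
      3 * m + 3 * B  ≤⟨ +-monoʳ-≤ (3 * m) (*-monoʳ-≤ 3 B≤m) ⟩
      3 * m + 3 * m  ≡⟨ cong (3 * m +_) (+-identityʳ (3 * m)) ⟨
      2 * (3 * m)    ∎)
      where
        open ≤-Reasoning
        kt≡ : B * (κ * w) * t ≡ m + B + Q * w * (3 * m)
        kt≡ = begin-equality
          B * (κ * w) * t                      ≡⟨ regroup B κ w t ⟩
          B * w * (κ * t)                      ≡⟨ cong (B * w *_) κt≡1+Q18A ⟩
          B * w * (1 + Q * (18 * A))           ≡⟨ expand A B Q ⟩
          m + B + Q * w * (3 * m)              ∎
          where
            regroup : ∀ B κ w t → B * (κ * w) * t ≡ B * w * (κ * t)
            regroup = solve-∀
            expand : ∀ A B Q → B * (1 + 3 * (2 * A)) * (1 + Q * (18 * A))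
                             ≡ 6 * A * B + B + Q * (1 + 3 * (2 * A)) * (3 * (6 * A * B))
            expand = solve-∀

2*3^n≢0 : ∀ n → NonZero (2 * 3 ^ n)
2*3^n≢0 n = m*n≢0 2 (3 ^ n) {{_}} {{m^n≢0 3 n}}

3^c*σ*6≤3^[1+u]⇒c<u : ∀ {c σ u} → 0 < 3 ^ c * σ → 3 ^ c * σ * 6 ≤ 3 ^ suc u → c < u
3^c*σ*6≤3^[1+u]⇒c<u {c} {σ} {u} 0<q q*6≤ = ≰⇒> λ u≤c → <⇒≱ (begin-strict
  3 * 3 ^ u        ≤⟨ *-monoʳ-≤ 3 (^-monoʳ-≤ 3 u≤c) ⟩
  3 * 3 ^ c        ≤⟨ *-monoʳ-≤ 3 (m≤m*n (3 ^ c) σ {{m*n≢0⇒n≢0 (3 ^ c) {{>-nonZero 0<q}}}}) ⟩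
  3 * q            <⟨ m<m+n (3 * q) (*-monoʳ-< 3 0<q) ⟩
  3 * q + 3 * q    ≡⟨ regroup q ⟩
  q * 6            ∎) q*6≤
  where
    open ≤-Reasoning
    q = 3 ^ c * σ
    regroup : ∀ q → 3 * q + 3 * q ≡ q * 6
    regroup = solve-∀

χ≤3 : ∀ u {q t} → 0 < q → q * 6 ≤ 3 ^ suc u → ¬ 2 ∣ t → ¬ 3 ∣ t →
  Colourable (2 * 3 ^ suc u) (λ d → d ≡ q * 6 ⊎ d ≡ t) 3
χ≤3 u {q} {t} 0<q q*6≤ 2∤t 3∤t with factor-powers 1<3 q 0<q
... | c , σ , refl , 3∤σ with m≤n⇒∃[o]m+o≡n {suc c} {u} (3^c*σ*6≤3^[1+u]⇒c<u 0<q q*6≤)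
...   | b , refl = let k , at-s , at-t = mult in
  middleThird-colourable (2 * 3 ^ suc u) {{2*3^n≢0 (suc u)}} {λ d → d ≡ 3 ^ c * σ * 6 ⊎ d ≡ t} k
    λ where
      (inj₁ refl) → subst₂ MiddleThird n≡ (cong (k *_) (s≡ (3 ^ c) σ)) at-s
      (inj₂ refl) → subst (λ n → MiddleThird n (k * t)) n≡ at-t
  where
    t⊥18·3ᶜ : Coprime t (18 * 3 ^ c)
    t⊥18·3ᶜ = subst (Coprime t) (regroup (3 ^ c))
      (coprime-* (∤⇒coprime prime[2] 2∤t) (coprime-^ (2 + c) (∤⇒coprime prime[3] 3∤t)))
      where
        regroup : ∀ A → 2 * (3 * (3 * A)) ≡ 18 * A
        regroup = solve-∀
    mult : ∃ λ k → MiddleThird (3 * (6 * 3 ^ c * 3 ^ b)) (k * (6 * 3 ^ c * σ))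
                 × MiddleThird (3 * (6 * 3 ^ c * 3 ^ b)) (k * t)
    mult = middleThird-multiplier {3 ^ c} {3 ^ b} {σ} {t} (m^n>0 3 c) 3∤σ t⊥18·3ᶜ
    n≡ : 3 * (6 * 3 ^ c * 3 ^ b) ≡ 2 * 3 ^ suc u
    n≡ = trans (regroup (3 ^ c) (3 ^ b)) (cong (λ x → 2 * (3 * (3 * x))) (sym (^-distribˡ-+-* 3 c b)))
      where
        regroup : ∀ A B → 3 * (6 * A * B) ≡ 2 * (3 * (3 * (A * B)))
        regroup = solve-∀
    s≡ : ∀ A σ → 6 * A * σ ≡ A * σ * 6
    s≡ = solve-∀

χ≥3 : ∀ u {q} {D : ℕ → Set} → D (q * 6) → 0 < q → q * 6 ≤ 3 ^ u →
  ∀ k → k < 3 → ¬ Colourable (2 * 3 ^ u) D k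
χ≥3 u {q} {D} Dq*6 0<q q*6≤3ᵘ with odd-^ 1 u
... | h , 3ᵘ≡1+2h =
  not-colourable-below-3 (2 * 3 ^ u) {{2*3^n≢0 u}} {D} Dq*6 (*-monoˡ-< 6 0<q) 2s≤n h n∣odd*s
  where
    2s≤n : q * 6 + q * 6 ≤ 2 * 3 ^ u
    2s≤n = ≤-trans (+-mono-≤ q*6≤3ᵘ q*6≤3ᵘ) (≤-reflexive (cong (3 ^ u +_) (sym (+-identityʳ (3 ^ u)))))
    n∣odd*s : 2 * 3 ^ u ∣ (1 + 2 * h) * (q * 6)
    n∣odd*s = divides (3 * q) (trans (cong (_* (q * 6)) (sym 3ᵘ≡1+2h)) (regroup (3 ^ u) q))
      where
        regroup : ∀ x q → x * (q * 6) ≡ 3 * q * (2 * x)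
        regroup = solve-∀

lemma3p3p5 : (u s t : ℕ) → 1 ≤ u →
    1 ≤ s → s ≤ (2 * 3 ^ u) / 2 → 1 ≤ t → t ≤ (2 * 3 ^ u) / 2 →
    6 ∣ s → ¬ (2 ∣ t) → ¬ (3 ∣ t) →
    ChromaticNumber (2 * 3 ^ u) (λ d → d ≡ s ⊎ d ≡ t) 3
lemma3p3p5 zero    _ _ ()
lemma3p3p5 (suc u) s t _ 0<s s≤n/2 _ _ (divides q refl) 2∤t 3∤t =
  χ≤3 u 0<q s≤3^[1+u] 2∤t 3∤t ,
  χ≥3 (suc u) {D = λ d → d ≡ q * 6 ⊎ d ≡ t} (inj₁ refl) 0<q s≤3^[1+u]
  where
    0<q : 0 < q
    0<q = >-nonZero⁻¹ q {{m*n≢0⇒m≢0 q {{>-nonZero 0<s}}}}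
    s≤3^[1+u] : q * 6 ≤ 3 ^ suc u
    s≤3^[1+u] = subst (q * 6 ≤_) (trans (cong (_/ 2) (*-comm 2 (3 ^ suc u))) (m*n/n≡m (3 ^ suc u) 2)) s≤n/2
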